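{- Let $\rho$ be a valuation of a fixpoint context $\Theta$, let $(\alpha:\sigma)\in\Theta$, and for $\varphi\in\mathcal{L}^s(\Theta;\tau)$ let $F_\varphi:\mathcal{P}([\![\sigma]\!])\to\mathcal{P}([\![\tau]\!])$, $S\mapsto[\![\varphi]\!]\rho[S/\alpha]$. (1) If $\varphi\in\mathcal{L}^s(\Theta;\tau)$ for some $s\in\{\pm,+,-\}$, then $F_\varphi$ is monotone. (2) If $\varphi\in\mathcal{L}^+(\Theta;\tau)$, then $F_\varphi$ is Scott-continuous, i.e. preserves unions of directed families. (3) If $\varphi\in\mathcal{L}^-(\Theta;\tau)$, then $F_\varphi$ is Scott-cocontinuous, i.e. preserves intersections of codirected (non-empty) families.
   Context: Pure types: closed types generated by $\tau ::= 1 \mid \tau\times\tau \mid \tau\to\tau \mid \tau+\tau \mid X \mid \mu X.\tau$. Interpretation in Scott domains: $[\![1]\!]=\{\bot<\top\}$; products componentwise with projections $\pi_1,\pi_2$; $[\![\sigma\to\tau]\!]$ = Scott-continuous functions, pointwise order; $[\![\sigma_1+\sigma_2]\!]$ = disjoint union with new bottom, injections $\mathrm{in}_1,\mathrm{in}_2$; $[\![\mu X.\tau]\!]$ = canonical bilimit solution with inverse isomorphisms $\mathrm{fold}:[\![\tau[\mu X.\tau/X]]\!]\to[\![\mu X.\tau]\!]$ and $\mathrm{unfold}$. $\mathcal{P}(A)$ is the powerset of $A$ ordered by inclusion. Formulae. Iteration terms: $t ::= i \mid 0 \mid t+1$. A fixpoint context $\Theta$ is a list of distinct fixpoint variables with pure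 types. For $s\in\{\pm,+,-\}$ the sets $\mathcal{L}^s(\Theta;\tau)$ are generated simultaneously by: $\top,\bot$, closure under $\wedge,\vee$; $\langle\langle\rangle\rangle\in\mathcal{L}^s(\Theta;1)$; $\varphi\in\mathcal{L}^s(\Theta;\tau_i)$ gives $\langle\pi_i\rangle\varphi\in\mathcal{L}^s(\Theta;\tau_1\times\tau_2)$ and $\langle\mathrm{in}_i\rangle\varphi\in\mathcal{L}^s(\Theta;\tau_1+\tau_2)$; $\varphi\in\mathcal{L}^s(\Theta;\tau[\mu X.\tau/X])$ gives $\langle\mathrm{fold}\rangle\varphi\in\mathcal{L}^s(\Theta;\mu X.\tau)$; $\alpha\in\mathcal{L}^s(\Theta;\tau)$ if $(\alpha:\tau)\in\Theta$; weakening in $\Theta$; $\varphi\in\mathcal{L}^s(\Theta,\alpha:\tau;\tau)$ gives $(\mu^t\alpha)\varphi,(\nu^t\alpha)\varphi\in\mathcal{L}^s(\Theta;\tau)$; $\varphi\in\mathcal{L}^+(\Theta;\tau)$ with $i\ \mathrm{Pos}\ \varphi$ gives $(\exists i)\varphi\in\mathcal{L}^+(\Theta;\tau)$; $\varphi\in\mathcal{L}^-(\Theta;\tau)$ with $i\ \mathrm{Neg}\ \varphi$ gives $(\forall i)\varphi\in\mathcal{L}^-(\Theta;\tau)$; $\psi\in\mathcal{L}^{ -s}(;\sigma)$, $\varphi\in\mathcal{L}^s(;\tau)$ give $\psi\Rightarrow\varphi\in\mathcal{L}^s(;\sigma\to\tau)$, where $-\pm=\pm$, $-+=-$, $--=+$.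 $FV$ = free iteration variables. $\mathrm{Pos},\mathrm{Neg}$ are the least relations with: $i\notin FV(\varphi)$ gives both; both preserved by $\wedge,\vee$ and the modalities $\langle\pi_i\rangle,\langle\mathrm{in}_i\rangle,\langle\mathrm{fold}\rangle$; $i\ \mathrm{Neg}\ \psi$, $i\ \mathrm{Pos}\ \varphi$ give $i\ \mathrm{Pos}\ (\psi\Rightarrow\varphi)$; $i\ \mathrm{Pos}\ \psi$, $i\ \mathrm{Neg}\ \varphi$ give $i\ \mathrm{Neg}\ (\psi\Rightarrow\varphi)$; $i\ \mathrm{Pos}\ \varphi$ gives $i\ \mathrm{Pos}\ (\exists j)\varphi$ and $i\ \mathrm{Pos}\ (\mu^t\beta)\varphi$; $i\ \mathrm{Pos}\ \varphi$, $i\notin FV(t)$ give $i\ \mathrm{Pos}\ (\nu^t\beta)\varphi$; $i\ \mathrm{Neg}\ \varphi$ gives $i\ \mathrm{Neg}\ (\forall j)\varphi$ and $i\ \mathrm{Neg}\ (\nu^t\beta)\varphi$; $i\ \mathrm{Neg}\ \varphi$, $i\notin FV(t)$ give $i\ \mathrm{Neg}\ (\mu^t\beta)\varphi$. Semantics. A valuation $\rho$ of $\Theta$ maps each $(\beta:\sigma')\in\Theta$ to a subset of $[\![\sigma']\!]$ and each iteration variable to a natural number. $[\![\varphi]\!]\rho\subseteq[\![\tau]\!]$: $\top\mapsto[\![\tau]\!]$, $\bot\mapsto\emptyset$, $\wedge\mapsto\cap$, $\vee\mapsto\cup$, $\beta\mapsto\rho(\beta)$, $\langle\langle\rangle\rangle\mapsto\{\top\}$,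 $\langle\pi_i\rangle\varphi\mapsto\{x\mid\pi_i(x)\in[\![\varphi]\!]\rho\}$, $\langle\mathrm{in}_i\rangle\varphi\mapsto\{\mathrm{in}_i(x)\mid x\in[\![\varphi]\!]\rho\}$, $\langle\mathrm{fold}\rangle\varphi\mapsto\{x\mid\mathrm{unfold}(x)\in[\![\varphi]\!]\rho\}$, $\psi\Rightarrow\varphi\mapsto\{f\mid\forall x\in[\![\psi]\!]\rho,\ f(x)\in[\![\varphi]\!]\rho\}$, $(\exists i)\varphi\mapsto\bigcup_n[\![\varphi]\!]\rho[n/i]$, $(\forall i)\varphi\mapsto\bigcap_n[\![\varphi]\!]\rho[n/i]$, $(\mu^t\beta)\varphi\mapsto G^{[\![t]\!]\rho}(\emptyset)$, $(\nu^t\beta)\varphi\mapsto G^{[\![t]\!]\rho}([\![\tau]\!])$ with $G(S)=[\![\varphi]\!]\rho[S/\beta]$. -}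

module Defs where

open import Level using (0ℓ)
open import Data.Nat using (ℕ; zero; suc; _≟_)
open import Data.Fin using (Fin; zero; suc)
open import Data.List using (List; []; _∷_)
open import Data.List.Membership.Propositional using (_∈_)
open import Data.List.Relation.Unary.All as All using (All; []; _∷_)
open import Data.Product using (Σ; _×_; _,_; ∃)
open import Data.Empty using (⊥)
import Data.Sum
import Relation.Nullary
open import Data.Unit using (⊤)
open import Relation.Nullary using (yes; no; ¬_)
open import Relation.Binary.PropositionalEquality using (_≡_)
open import Relation.Unary using (Pred; _⊆_; _≐_)

data Ty (n : ℕ) : Set where
  unitᵗ : Ty n
  _×ᵗ_  : Ty n → Ty n → Ty n
  _→ᵗ_  : Ty n → Ty n → Ty n
  _+ᵗ_  : Ty n → Ty n → Ty n
  tv    : Fin n → Ty n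
  μᵗ    : Ty (suc n) → Ty n

Ren : ℕ → ℕ → Set
Ren n m = Fin n → Fin m

extR : ∀ {n m} → Ren n m → Ren (suc n) (suc m)
extR r zero    = zero
extR r (suc i) = suc (r i)

rename : ∀ {n m} → Ren n m → Ty n → Ty m
rename r unitᵗ     = unitᵗ
rename r (a ×ᵗ b)  = rename r a ×ᵗ rename r b
rename r (a →ᵗ b)  = rename r a →ᵗ rename r b
rename r (a +ᵗ b)  = rename r a +ᵗ rename r b
rename r (tv i)    = tv (r i)
rename r (μᵗ a)    = μᵗ (rename (extR r) a)

Sub : ℕ → ℕ → Set
Sub n m = Fin n → Ty m

extS : ∀ {n m} → Sub n m → Sub (suc n) (suc m)
extS s zero    = tv zero
extS s (suc i) = rename suc (s i)

subst : ∀ {n m} → Sub n m → Ty n → Ty m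
subst s unitᵗ     = unitᵗ
subst s (a ×ᵗ b)  = subst s a ×ᵗ subst s b
subst s (a →ᵗ b)  = subst s a →ᵗ subst s b
subst s (a +ᵗ b)  = subst s a +ᵗ subst s b
subst s (tv i)    = s i
subst s (μᵗ a)    = μᵗ (subst (extS s) a)

_[_]₀ : ∀ {n} → Ty (suc n) → Ty n → Ty n
τ [ σ ]₀ = subst (λ { zero → σ ; (suc i) → tv i }) τ

PType : Set
PType = Ty 0

data Sign : Set where
  pm plus minus : Sign

negS : Sign → Sign
negS pm    = pm
negS plus  = minus
negS minus = plus

data ITerm : Set where
  ivar : ℕ → ITerm
  izero : ITerm
  isuc : ITerm → ITerm

data FreshT (i : ℕ) : ITerm → Set where
  fvar  : ∀ {j} → ¬ (i ≡ j) → FreshT i (ivar j)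
  fzero : FreshT i izero
  fsuc  : ∀ {t} → FreshT i t → FreshT i (isuc t)

-- Fixpoint contexts: lists of pure types; fixpoint variables are
-- de Bruijn membership proofs  (α : σ) ∈ Θ.  "Θ, α:τ" is  τ ∷ Θ.
FCtx : Set
FCtx = List PType

data Form : Sign → FCtx → PType → Set
data Fresh (i : ℕ) : ∀ {s Θ τ} → Form s Θ τ → Set
data Pos (i : ℕ) : ∀ {s Θ τ} → Form s Θ τ → Set
data Neg (i : ℕ) : ∀ {s Θ τ} → Form s Θ τ → Set

data Form where
  ⊤f ⊥f   : ∀ {s Θ τ} → Form s Θ τ
  _∧f_ _∨f_ : ∀ {s Θ τ} → Form s Θ τ → Form s Θ τ → Form s Θ τ
  ⟨⟨⟩⟩    : ∀ {s Θ} → Form s Θ unitᵗ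
  ⟨π₁⟩    : ∀ {s Θ τ₁ τ₂} → Form s Θ τ₁ → Form s Θ (τ₁ ×ᵗ τ₂)
  ⟨π₂⟩    : ∀ {s Θ τ₁ τ₂} → Form s Θ τ₂ → Form s Θ (τ₁ ×ᵗ τ₂)
  ⟨in₁⟩   : ∀ {s Θ τ₁ τ₂} → Form s Θ τ₁ → Form s Θ (τ₁ +ᵗ τ₂)
  ⟨in₂⟩   : ∀ {s Θ τ₁ τ₂} → Form s Θ τ₂ → Form s Θ (τ₁ +ᵗ τ₂)
  ⟨fold⟩  : ∀ {s Θ} {τ : Ty 1} → Form s Θ (τ [ μᵗ τ ]₀) → Form s Θ (μᵗ τ)
  fvarF   : ∀ {s Θ τ} → τ ∈ Θ → Form s Θ τ
  μF νF   : ∀ {s Θ τ} → ITerm → Form s (τ ∷ Θ) τ → Form s Θ τ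
  ∃F      : ∀ {Θ τ} (i : ℕ) (φ : Form plus Θ τ) → Pos i φ → Form plus Θ τ
  ∀F      : ∀ {Θ τ} (i : ℕ) (φ : Form minus Θ τ) → Neg i φ → Form minus Θ τ
  _⇒F_    : ∀ {s Θ σ τ} → Form (negS s) [] σ → Form s [] τ → Form s Θ (σ →ᵗ τ)

data Fresh i where
  ⊤r : ∀ {s Θ τ} → Fresh i (⊤f {s} {Θ} {τ})
  ⊥r : ∀ {s Θ τ} → Fresh i (⊥f {s} {Θ} {τ})
  ∧r : ∀ {s Θ τ} {φ ψ : Form s Θ τ} → Fresh i φ → Fresh i ψ → Fresh i (φ ∧f ψ)
  ∨r : ∀ {s Θ τ} {φ ψ : Form s Θ τ} → Fresh i φ → Fresh i ψ → Fresh i (φ ∨f ψ)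
  ⟨⟨⟩⟩r : ∀ {s Θ} → Fresh i (⟨⟨⟩⟩ {s} {Θ})
  π₁r : ∀ {s Θ τ₁ τ₂} {φ : Form s Θ τ₁} → Fresh i φ → Fresh i (⟨π₁⟩ {τ₂ = τ₂} φ)
  π₂r : ∀ {s Θ τ₁ τ₂} {φ : Form s Θ τ₂} → Fresh i φ → Fresh i (⟨π₂⟩ {τ₁ = τ₁} φ)
  in₁r : ∀ {s Θ τ₁ τ₂} {φ : Form s Θ τ₁} → Fresh i φ → Fresh i (⟨in₁⟩ {τ₂ = τ₂} φ)
  in₂r : ∀ {s Θ τ₁ τ₂} {φ : Form s Θ τ₂} → Fresh i φ → Fresh i (⟨in₂⟩ {τ₁ = τ₁} φ)
  foldr : ∀ {s Θ} {τ : Ty 1} {φ : Form s Θ (τ [ μᵗ τ ]₀)} → Fresh i φ → Fresh i (⟨fold⟩ {τ = τ} φ)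
  varr : ∀ {s Θ τ} {x : τ ∈ Θ} → Fresh i (fvarF {s} x)
  μr : ∀ {s Θ τ t} {φ : Form s (τ ∷ Θ) τ} → FreshT i t → Fresh i φ → Fresh i (μF t φ)
  νr : ∀ {s Θ τ t} {φ : Form s (τ ∷ Θ) τ} → FreshT i t → Fresh i φ → Fresh i (νF t φ)
  ∃bound : ∀ {Θ τ} {φ : Form plus Θ τ} {p : Pos i φ} → Fresh i (∃F i φ p)
  ∃r : ∀ {Θ τ j} {φ : Form plus Θ τ} {p : Pos j φ} → Fresh i φ → Fresh i (∃F j φ p)
  ∀bound : ∀ {Θ τ} {φ : Form minus Θ τ} {p : Neg i φ} → Fresh i (∀F i φ p)
  ∀r : ∀ {Θ τ j} {φ : Form minus Θ τ} {p : Neg j φ} → Fresh i φ → Fresh i (∀F j φ p)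
  ⇒r : ∀ {s Θ σ τ} {ψ : Form (negS s) [] σ} {φ : Form s [] τ} →
       Fresh i ψ → Fresh i φ → Fresh i (_⇒F_ {Θ = Θ} ψ φ)

data Pos i where
  freshP : ∀ {s Θ τ} {φ : Form s Θ τ} → Fresh i φ → Pos i φ
  ∧P : ∀ {s Θ τ} {φ ψ : Form s Θ τ} → Pos i φ → Pos i ψ → Pos i (φ ∧f ψ)
  ∨P : ∀ {s Θ τ} {φ ψ : Form s Θ τ} → Pos i φ → Pos i ψ → Pos i (φ ∨f ψ)
  π₁P : ∀ {s Θ τ₁ τ₂} {φ : Form s Θ τ₁} → Pos i φ → Pos i (⟨π₁⟩ {τ₂ = τ₂} φ)
  π₂P : ∀ {s Θ τ₁ τ₂} {φ : Form s Θ τ₂} → Pos i φ → Pos i (⟨π₂⟩ {τ₁ = τ₁} φ)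
  in₁P : ∀ {s Θ τ₁ τ₂} {φ : Form s Θ τ₁} → Pos i φ → Pos i (⟨in₁⟩ {τ₂ = τ₂} φ)
  in₂P : ∀ {s Θ τ₁ τ₂} {φ : Form s Θ τ₂} → Pos i φ → Pos i (⟨in₂⟩ {τ₁ = τ₁} φ)
  foldP : ∀ {s Θ} {τ : Ty 1} {φ : Form s Θ (τ [ μᵗ τ ]₀)} → Pos i φ → Pos i (⟨fold⟩ {τ = τ} φ)
  ⇒P : ∀ {s Θ σ τ} {ψ : Form (negS s) [] σ} {φ : Form s [] τ} →
       Neg i ψ → Pos i φ → Pos i (_⇒F_ {Θ = Θ} ψ φ)
  ∃P : ∀ {Θ τ j} {φ : Form plus Θ τ} {p : Pos j φ} → Pos i φ → Pos i (∃F j φ p)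
  μP : ∀ {s Θ τ t} {φ : Form s (τ ∷ Θ) τ} → Pos i φ → Pos i (μF t φ)
  νP : ∀ {s Θ τ t} {φ : Form s (τ ∷ Θ) τ} → Pos i φ → FreshT i t → Pos i (νF t φ)

data Neg i where
  freshN : ∀ {s Θ τ} {φ : Form s Θ τ} → Fresh i φ → Neg i φ
  ∧N : ∀ {s Θ τ} {φ ψ : Form s Θ τ} → Neg i φ → Neg i ψ → Neg i (φ ∧f ψ)
  ∨N : ∀ {s Θ τ} {φ ψ : Form s Θ τ} → Neg i φ → Neg i ψ → Neg i (φ ∨f ψ)
  π₁N : ∀ {s Θ τ₁ τ₂} {φ : Form s Θ τ₁} → Neg i φ → Neg i (⟨π₁⟩ {τ₂ = τ₂} φ)
  π₂N : ∀ {s Θ τ₁ τ₂} {φ : Form s Θ τ₂} → Neg i φ → Neg i (⟨π₂⟩ {τ₁ = τ₁} φ)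
  in₁N : ∀ {s Θ τ₁ τ₂} {φ : Form s Θ τ₁} → Neg i φ → Neg i (⟨in₁⟩ {τ₂ = τ₂} φ)
  in₂N : ∀ {s Θ τ₁ τ₂} {φ : Form s Θ τ₂} → Neg i φ → Neg i (⟨in₂⟩ {τ₁ = τ₁} φ)
  foldN : ∀ {s Θ} {τ : Ty 1} {φ : Form s Θ (τ [ μᵗ τ ]₀)} → Neg i φ → Neg i (⟨fold⟩ {τ = τ} φ)
  ⇒N : ∀ {s Θ σ τ} {ψ : Form (negS s) [] σ} {φ : Form s [] τ} →
       Pos i ψ → Neg i φ → Neg i (_⇒F_ {Θ = Θ} ψ φ)
  ∀N : ∀ {Θ τ j} {φ : Form minus Θ τ} {p : Neg j φ} → Neg i φ → Neg i (∀F j φ p)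
  νN : ∀ {s Θ τ t} {φ : Form s (τ ∷ Θ) τ} → Neg i φ → Neg i (νF t φ)
  μN : ∀ {s Θ τ t} {φ : Form s (τ ∷ Θ) τ} → Neg i φ → FreshT i t → Neg i (μF t φ)

-- Semantic models of pure types.  The paper uses the Scott-domain
-- interpretation; the statement is made for every interpretation
-- providing the operations the semantics of formulae uses
--.

record Model : Set₁ where
  field
    D      : PType → Set
    topU   : D unitᵗ
    π₁     : ∀ {σ τ} → D (σ ×ᵗ τ) → D σ
    π₂     : ∀ {σ τ} → D (σ ×ᵗ τ) → D τ
    in₁    : ∀ {σ τ} → D σ → D (σ +ᵗ τ)
    in₂    : ∀ {σ τ} → D τ → D (σ +ᵗ τ)
    in₁-inj : ∀ {σ τ} {x y : D σ} → in₁ {σ} {τ} x ≡ in₁ y → x ≡ y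
    in₂-inj : ∀ {σ τ} {x y : D τ} → in₂ {σ} {τ} x ≡ in₂ y → x ≡ y
    fold   : ∀ {τ : Ty 1} → D (τ [ μᵗ τ ]₀) → D (μᵗ τ)
    unfold : ∀ {τ : Ty 1} → D (μᵗ τ) → D (τ [ μᵗ τ ]₀)
    fold-unfold : ∀ {τ : Ty 1} (x : D (μᵗ τ)) → fold {τ} (unfold x) ≡ x
    unfold-fold : ∀ {τ : Ty 1} (x : D (τ [ μᵗ τ ]₀)) → unfold {τ} (fold x) ≡ x
    app    : ∀ {σ τ} → D (σ →ᵗ τ) → D σ → D τ

𝒫 : Set → Set₁
𝒫 A = Pred A 0ℓ

module Semantics (M : Model) where
  open Model M

  record Val (Θ : FCtx) : Set₁ where
    constructor val
    field
      sets  : All (λ σ → 𝒫 (D σ)) Θ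
      iters : ℕ → ℕ
  open Val public

  _[_/ₛ_] : ∀ {Θ σ} → Val Θ → 𝒫 (D σ) → σ ∈ Θ → Val Θ
  ρ [ S /ₛ α ] = val (All.updateAt α (λ _ → S) (sets ρ)) (iters ρ)

  _[_/ᵢ_] : ∀ {Θ} → Val Θ → ℕ → ℕ → Val Θ
  ρ [ n /ᵢ i ] = val (sets ρ) upd
    where
      upd : ℕ → ℕ
      upd j with j ≟ i
      ... | yes _ = n
      ... | no _  = iters ρ j

  ⟦_⟧ᵗ : ITerm → (ℕ → ℕ) → ℕ
  ⟦ ivar i ⟧ᵗ ι = ι i
  ⟦ izero ⟧ᵗ ι = zero
  ⟦ isuc t ⟧ᵗ ι = suc (⟦ t ⟧ᵗ ι)

  iter : ∀ {A : Set₁} → ℕ → (A → A) → A → A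
  iter zero    G a = a
  iter (suc n) G a = G (iter n G a)

  ⟦_⟧ : ∀ {s Θ τ} → Form s Θ τ → Val Θ → 𝒫 (D τ)
  ⟦ ⊤f ⟧ ρ x = ⊤
  ⟦ ⊥f ⟧ ρ x = ⊥
  ⟦ φ ∧f ψ ⟧ ρ x = ⟦ φ ⟧ ρ x × ⟦ ψ ⟧ ρ x
  ⟦ φ ∨f ψ ⟧ ρ x = Data.Sum._⊎_ (⟦ φ ⟧ ρ x) (⟦ ψ ⟧ ρ x)
  ⟦ ⟨⟨⟩⟩ ⟧ ρ x = x ≡ topU
  ⟦ ⟨π₁⟩ φ ⟧ ρ x = ⟦ φ ⟧ ρ (π₁ x)
  ⟦ ⟨π₂⟩ φ ⟧ ρ x = ⟦ φ ⟧ ρ (π₂ x)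
  ⟦ ⟨in₁⟩ φ ⟧ ρ x = Σ _ λ y → ⟦ φ ⟧ ρ y × x ≡ in₁ y
  ⟦ ⟨in₂⟩ φ ⟧ ρ x = Σ _ λ y → ⟦ φ ⟧ ρ y × x ≡ in₂ y
  ⟦ ⟨fold⟩ {τ = τ} φ ⟧ ρ x = ⟦ φ ⟧ ρ (unfold {τ} x)
  ⟦ fvarF α ⟧ ρ x = All.lookup (sets ρ) α x
  ⟦ μF t φ ⟧ ρ = iter (⟦ t ⟧ᵗ (iters ρ)) (λ S → ⟦ φ ⟧ (val (S ∷ sets ρ) (iters ρ))) (λ _ → ⊥)
  ⟦ νF t φ ⟧ ρ = iter (⟦ t ⟧ᵗ (iters ρ)) (λ S → ⟦ φ ⟧ (val (S ∷ sets ρ) (iters ρ))) (λ _ → ⊤)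
  ⟦ ∃F i φ _ ⟧ ρ x = Σ ℕ λ n → ⟦ φ ⟧ (ρ [ n /ᵢ i ]) x
  ⟦ ∀F i φ _ ⟧ ρ x = (n : ℕ) → ⟦ φ ⟧ (ρ [ n /ᵢ i ]) x
  ⟦ ψ ⇒F φ ⟧ ρ f = ∀ x → ⟦ ψ ⟧ (val [] (iters ρ)) x → ⟦ φ ⟧ (val [] (iters ρ)) (app f x)

  Fφ : ∀ {s Θ σ τ} → Form s Θ τ → Val Θ → σ ∈ Θ → 𝒫 (D σ) → 𝒫 (D τ)
  Fφ φ ρ α S = ⟦ φ ⟧ (ρ [ S /ₛ α ])

⋃ : ∀ {A : Set} {I : Set} → (I → 𝒫 A) → 𝒫 A
⋃ {I = I} S x = Σ I λ k → S k x

⋂ : ∀ {A : Set} {I : Set} → (I → 𝒫 A) → 𝒫 A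
⋂ {I = I} S x = (k : I) → S k x

Directed : ∀ {A I : Set} → (I → 𝒫 A) → Set
Directed {I = I} S = I × ((k l : I) → Σ I λ m → (S k ⊆ S m) × (S l ⊆ S m))

Codirected : ∀ {A I : Set} → (I → 𝒫 A) → Set
Codirected {I = I} S = I × ((k l : I) → Σ I λ m → (S m ⊆ S k) × (S m ⊆ S l))

Monotone : ∀ {A B : Set} → (𝒫 A → 𝒫 B) → Set₁
Monotone F = ∀ {S T} → S ⊆ T → F S ⊆ F T

ScottContinuous : ∀ {A B : Set} → (𝒫 A → 𝒫 B) → Set₁
ScottContinuous {A} F = (I : Set) (S : I → 𝒫 A) → Directed S → F (⋃ S) ≐ ⋃ (λ k → F (S k))

ScottCocontinuous : ∀ {A B : Set} → (𝒫 A → 𝒫 B) → Set₁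
ScottCocontinuous {A} F = (I : Set) (S : I → 𝒫 A) → Codirected S → F (⋂ S) ≐ ⋂ (λ k → F (S k))

module Submission where

open import Defs
open import Level using (0ℓ)
open import Data.Product using (_×_)
open import Data.List.Membership.Propositional using (_∈_)
open import Axiom.ExcludedMiddle using (ExcludedMiddle)

open import Axiom.DoubleNegationElimination using (em⇒dne)
open import Data.Nat using (ℕ; zero; suc; _≟_)
open import Data.Product using (Σ; ∃; _,_; proj₁; proj₂)
open import Data.Sum using (_⊎_; inj₁; inj₂)
open import Data.Unit using (tt)
open import Data.List using (_∷_)
open import Data.List.Relation.Unary.Any using (here; there)
open import Data.List.Relation.Unary.All as All using (All; _∷_)
open import Relation.Nullary using (yes; no; ¬_; contradiction)
open import Relation.Binary.PropositionalEquality
  using (_≡_; _≗_; refl; sym; trans; cong) renaming (subst to ≡-subst)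
open import Relation.Unary using (_⊆_)

-- Generalise from one fixpoint variable to all of them at once: ⟦ φ ⟧ is
-- monotone in the whole set-valuation, and for φ ∈ L⁺ (resp. L⁻) it maps a
-- set-valuation covered by a directed family (resp. containing the intersection
-- of a codirected one) into the union (resp. from the intersection) of the
-- images.  This stronger statement survives the binders: the n-th approximant
-- of μ/ν is again covered, by induction on n, so the bound variable merely
-- extends the family.  ∧ commutes with directed unions by directedness; ∨
-- commutes with codirected intersections only classically, ⟨inᵢ⟩ because inᵢ
-- is injective.  Implications have no free fixpoint variables, which is why ⇒
-- may mix polarities.

monotone-⋃⊆ : ∀ {A B I : Set} {F : 𝒫 A → 𝒫 B} → Monotone F →
  (S : I → 𝒫 A) → ⋃ (λ k → F (S k)) ⊆ F (⋃ S)
monotone-⋃⊆ F-mono S (k , p) = F-mono (λ q → k , q) p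

monotone-⊆⋂ : ∀ {A B I : Set} {F : 𝒫 A → 𝒫 B} → Monotone F →
  (S : I → 𝒫 A) → F (⋂ S) ⊆ ⋂ (λ k → F (S k))
monotone-⊆⋂ F-mono S p k = F-mono (λ q → q k) p

∀⊎∀-codirected : ExcludedMiddle 0ℓ → {I : Set} (A B : I → Set) →
  (∀ k l → Σ I λ m → (A m → A k) × (B m → B l)) →
  (∀ k → A k ⊎ B k) → (∀ k → A k) ⊎ (∀ k → B k)
∀⊎∀-codirected em A B codir A⊎B with em {∃ λ k → ¬ A k}
... | no ∄¬A = inj₁ λ k → em⇒dne em λ ¬Ak → ∄¬A (k , ¬Ak)
... | yes (k₁ , ¬Ak₁) = inj₂ B-everywhere
  where
    B-everywhere : ∀ l → B l
    B-everywhere l with codir k₁ l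
    ... | m , Am⇒Ak₁ , Bm⇒Bl with A⊎B m
    ...   | inj₁ Am = contradiction (Am⇒Ak₁ Am) ¬Ak₁
    ...   | inj₂ Bm = Bm⇒Bl Bm

injective-image-⋂ : ∀ {A X I : Set} {g : A → X} → (∀ {y y'} → g y ≡ g y' → y ≡ y') →
  (P : I → A → Set) → I → ∀ {x} →
  (∀ k → Σ A λ y → P k y × x ≡ g y) → Σ A λ y → (∀ k → P k y) × x ≡ g y
injective-image-⋂ g-inj P k₀ in-images with in-images k₀
... | y₀ , _ , x≡gy₀ = y₀ , in-every , x≡gy₀
  where
    in-every : ∀ k → P k y₀
    in-every k with in-images k
    ... | y , Pky , x≡gy = ≡-subst (P k) (g-inj (trans (sym x≡gy) x≡gy₀)) Pky

module _ (M : Model) where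
  open Model M
  open Semantics M

  SetVal : FCtx → Set₁
  SetVal Θ = All (λ σ → 𝒫 (D σ)) Θ

  infix 4 _≤ₛ_ _⊆⋃ₛ_ ⋂ₛ_⊆_

  _≤ₛ_ : ∀ {Θ} → SetVal Θ → SetVal Θ → Set
  _≤ₛ_ {Θ} a b = ∀ {σ} (β : σ ∈ Θ) → All.lookup a β ⊆ All.lookup b β

  _⊆⋃ₛ_ : ∀ {Θ I} → SetVal Θ → (I → SetVal Θ) → Set
  _⊆⋃ₛ_ {Θ} a f = ∀ {σ} (β : σ ∈ Θ) → All.lookup a β ⊆ ⋃ (λ k → All.lookup (f k) β)

  ⋂ₛ_⊆_ : ∀ {Θ I} → (I → SetVal Θ) → SetVal Θ → Set
  ⋂ₛ_⊆_ {Θ} f a = ∀ {σ} (β : σ ∈ Θ) → ⋂ (λ k → All.lookup (f k) β) ⊆ All.lookup a β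

  Directedₛ : ∀ {Θ I} → (I → SetVal Θ) → Set
  Directedₛ {I = I} f = ∀ k l → Σ I λ m → f k ≤ₛ f m × f l ≤ₛ f m

  Codirectedₛ : ∀ {Θ I} → (I → SetVal Θ) → Set
  Codirectedₛ {I = I} f = ∀ k l → Σ I λ m → f m ≤ₛ f k × f m ≤ₛ f l

  ∷-mono-≤ₛ : ∀ {Θ τ} {S S' : 𝒫 (D τ)} {a b : SetVal Θ} →
    S ⊆ S' → a ≤ₛ b → (S ∷ a) ≤ₛ (S' ∷ b)
  ∷-mono-≤ₛ S⊆S' a≤b (here refl) = S⊆S'
  ∷-mono-≤ₛ S⊆S' a≤b (there β)   = a≤b β

  ∷-directed : ∀ {Θ τ I} {g : SetVal Θ → 𝒫 (D τ)} {f : I → SetVal Θ} →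
    (∀ {a b} → a ≤ₛ b → g a ⊆ g b) → Directedₛ f → Directedₛ (λ k → g (f k) ∷ f k)
  ∷-directed g-mono dir k l with dir k l
  ... | m , k≤m , l≤m = m , ∷-mono-≤ₛ (g-mono k≤m) k≤m , ∷-mono-≤ₛ (g-mono l≤m) l≤m

  ∷-codirected : ∀ {Θ τ I} {g : SetVal Θ → 𝒫 (D τ)} {f : I → SetVal Θ} →
    (∀ {a b} → a ≤ₛ b → g a ⊆ g b) → Codirectedₛ f → Codirectedₛ (λ k → g (f k) ∷ f k)
  ∷-codirected g-mono codir k l with codir k l
  ... | m , m≤k , m≤l = m , ∷-mono-≤ₛ (g-mono m≤k) m≤k , ∷-mono-≤ₛ (g-mono m≤l) m≤l

  _[_]≔_ : ∀ {Θ σ} → SetVal Θ → σ ∈ Θ → 𝒫 (D σ) → SetVal Θ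
  xs [ α ]≔ S = All.updateAt α (λ _ → S) xs

  []≔-mono : ∀ {Θ σ} (xs : SetVal Θ) (α : σ ∈ Θ) {S T : 𝒫 (D σ)} →
    S ⊆ T → xs [ α ]≔ S ≤ₛ xs [ α ]≔ T
  []≔-mono (x ∷ xs) (here refl) S⊆T (here refl) = S⊆T
  []≔-mono (x ∷ xs) (here refl) S⊆T (there β)   = λ q → q
  []≔-mono (x ∷ xs) (there α)   S⊆T (here refl) = λ q → q
  []≔-mono (x ∷ xs) (there α)   S⊆T (there β)   = []≔-mono xs α S⊆T β

  []≔-directed : ∀ {Θ σ I} (xs : SetVal Θ) (α : σ ∈ Θ) {S : I → 𝒫 (D σ)} →
    (∀ k l → Σ I λ m → S k ⊆ S m × S l ⊆ S m) → Directedₛ (λ k → xs [ α ]≔ S k)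
  []≔-directed xs α dir k l with dir k l
  ... | m , k⊆m , l⊆m = m , []≔-mono xs α k⊆m , []≔-mono xs α l⊆m

  []≔-codirected : ∀ {Θ σ I} (xs : SetVal Θ) (α : σ ∈ Θ) {S : I → 𝒫 (D σ)} →
    (∀ k l → Σ I λ m → S m ⊆ S k × S m ⊆ S l) → Codirectedₛ (λ k → xs [ α ]≔ S k)
  []≔-codirected xs α codir k l with codir k l
  ... | m , m⊆k , m⊆l = m , []≔-mono xs α m⊆k , []≔-mono xs α m⊆l

  ⟦⟧ᵗ-cong : ∀ t {ι ι' : ℕ → ℕ} → ι ≗ ι' → ⟦ t ⟧ᵗ ι ≡ ⟦ t ⟧ᵗ ι'
  ⟦⟧ᵗ-cong (ivar i) ι≗ι' = ι≗ι' i
  ⟦⟧ᵗ-cong izero    ι≗ι' = refl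
  ⟦⟧ᵗ-cong (isuc t) ι≗ι' = cong suc (⟦⟧ᵗ-cong t ι≗ι')

  [/ᵢ]-cong : ∀ {Θ} {a b : SetVal Θ} {ι ι' : ℕ → ℕ} n i → ι ≗ ι' →
    iters (val a ι [ n /ᵢ i ]) ≗ iters (val b ι' [ n /ᵢ i ])
  [/ᵢ]-cong n i ι≗ι' j with j ≟ i
  ... | yes _ = refl
  ... | no _  = ι≗ι' j

  iter-mono : ∀ {X : Set} {G G' : 𝒫 X → 𝒫 X} → (∀ {S S'} → S ⊆ S' → G S ⊆ G' S') →
    ∀ n {z z'} → z ⊆ z' → iter n G z ⊆ iter n G' z'
  iter-mono G⊆G' zero    z⊆z' = z⊆z'
  iter-mono G⊆G' (suc n) z⊆z' = G⊆G' (iter-mono G⊆G' n z⊆z')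

  -- ⟦ μF t φ ⟧ and ⟦ νF t φ ⟧ are stages seeded with z = ∅ and z = everything.
  stage : ∀ {s Θ τ} → Form s (τ ∷ Θ) τ → SetVal Θ → (ℕ → ℕ) → 𝒫 (D τ) → ℕ → 𝒫 (D τ)
  stage φ a ι z n = iter n (λ S → ⟦ φ ⟧ (val (S ∷ a) ι)) z

  -- ρ [ n /ᵢ i ] builds a new function, so iteration environments can only be
  -- compared extensionally.
  ⟦⟧-mono : ∀ {s Θ τ} (φ : Form s Θ τ) {a b : SetVal Θ} {ι ι' : ℕ → ℕ} →
    a ≤ₛ b → ι ≗ ι' → ⟦ φ ⟧ (val a ι) ⊆ ⟦ φ ⟧ (val b ι')
  ⟦⟧-mono ⊤f         a≤b ι≗ι' p = p
  ⟦⟧-mono ⊥f         a≤b ι≗ι' p = p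
  ⟦⟧-mono (φ ∧f ψ)   a≤b ι≗ι' (p , q) = ⟦⟧-mono φ a≤b ι≗ι' p , ⟦⟧-mono ψ a≤b ι≗ι' q
  ⟦⟧-mono (φ ∨f ψ)   a≤b ι≗ι' (inj₁ p) = inj₁ (⟦⟧-mono φ a≤b ι≗ι' p)
  ⟦⟧-mono (φ ∨f ψ)   a≤b ι≗ι' (inj₂ q) = inj₂ (⟦⟧-mono ψ a≤b ι≗ι' q)
  ⟦⟧-mono ⟨⟨⟩⟩       a≤b ι≗ι' p = p
  ⟦⟧-mono (⟨π₁⟩ φ)   a≤b ι≗ι' p = ⟦⟧-mono φ a≤b ι≗ι' p
  ⟦⟧-mono (⟨π₂⟩ φ)   a≤b ι≗ι' p = ⟦⟧-mono φ a≤b ι≗ι' p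
  ⟦⟧-mono (⟨in₁⟩ φ)  a≤b ι≗ι' (y , p , x≡y) = y , ⟦⟧-mono φ a≤b ι≗ι' p , x≡y
  ⟦⟧-mono (⟨in₂⟩ φ)  a≤b ι≗ι' (y , p , x≡y) = y , ⟦⟧-mono φ a≤b ι≗ι' p , x≡y
  ⟦⟧-mono (⟨fold⟩ φ) a≤b ι≗ι' p = ⟦⟧-mono φ a≤b ι≗ι' p
  ⟦⟧-mono (fvarF β)  a≤b ι≗ι' p = a≤b β p
  ⟦⟧-mono (μF t φ) {b = b} {ι} {ι'} a≤b ι≗ι' {x} p =
    ≡-subst (λ n → stage φ b ι' _ n x) (⟦⟧ᵗ-cong t ι≗ι')
    (iter-mono (λ S⊆S' → ⟦⟧-mono φ (∷-mono-≤ₛ S⊆S' a≤b) ι≗ι') (⟦ t ⟧ᵗ ι) (λ q → q) p)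
  ⟦⟧-mono (νF t φ) {b = b} {ι} {ι'} a≤b ι≗ι' {x} p =
    ≡-subst (λ n → stage φ b ι' _ n x) (⟦⟧ᵗ-cong t ι≗ι')
    (iter-mono (λ S⊆S' → ⟦⟧-mono φ (∷-mono-≤ₛ S⊆S' a≤b) ι≗ι') (⟦ t ⟧ᵗ ι) (λ q → q) p)
  ⟦⟧-mono (∃F i φ _) a≤b ι≗ι' (n , p) = n , ⟦⟧-mono φ a≤b ([/ᵢ]-cong n i ι≗ι') p
  ⟦⟧-mono (∀F i φ _) a≤b ι≗ι' p n = ⟦⟧-mono φ a≤b ([/ᵢ]-cong n i ι≗ι') (p n)
  ⟦⟧-mono (ψ ⇒F φ)   a≤b ι≗ι' p x q =
    ⟦⟧-mono φ (λ ()) ι≗ι' (p x (⟦⟧-mono ψ (λ ()) (λ j → sym (ι≗ι' j)) q))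

  ⟦⟧-monoˢ : ∀ {s Θ τ} (φ : Form s Θ τ) {a b : SetVal Θ} {ι : ℕ → ℕ} →
    a ≤ₛ b → ⟦ φ ⟧ (val a ι) ⊆ ⟦ φ ⟧ (val b ι)
  ⟦⟧-monoˢ φ a≤b = ⟦⟧-mono φ a≤b (λ _ → refl)

  stage-mono : ∀ {s Θ τ} (φ : Form s (τ ∷ Θ) τ) {a b : SetVal Θ} ι z n →
    a ≤ₛ b → stage φ a ι z n ⊆ stage φ b ι z n
  stage-mono φ ι z n a≤b = iter-mono (λ S⊆S' → ⟦⟧-monoˢ φ (∷-mono-≤ₛ S⊆S' a≤b)) n (λ q → q)

  module Continuity {I : Set} (k₀ : I) where

    mutual
      ⟦⟧-⊆⋃ : ∀ {Θ τ} (φ : Form plus Θ τ) (f : I → SetVal Θ) (a : SetVal Θ) ι →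
        Directedₛ f → a ⊆⋃ₛ f → ⟦ φ ⟧ (val a ι) ⊆ ⋃ (λ k → ⟦ φ ⟧ (val (f k) ι))
      ⟦⟧-⊆⋃ ⊤f f a ι dir cov p = k₀ , tt
      ⟦⟧-⊆⋃ ⊥f f a ι dir cov ()
      ⟦⟧-⊆⋃ (φ ∧f ψ) f a ι dir cov (p , q)
        with ⟦⟧-⊆⋃ φ f a ι dir cov p | ⟦⟧-⊆⋃ ψ f a ι dir cov q
      ... | k , pₖ | l , qₗ with dir k l
      ...   | m , k≤m , l≤m = m , ⟦⟧-monoˢ φ k≤m pₖ , ⟦⟧-monoˢ ψ l≤m qₗ
      ⟦⟧-⊆⋃ (φ ∨f ψ) f a ι dir cov (inj₁ p) with ⟦⟧-⊆⋃ φ f a ι dir cov p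
      ... | k , pₖ = k , inj₁ pₖ
      ⟦⟧-⊆⋃ (φ ∨f ψ) f a ι dir cov (inj₂ q) with ⟦⟧-⊆⋃ ψ f a ι dir cov q
      ... | k , qₖ = k , inj₂ qₖ
      ⟦⟧-⊆⋃ ⟨⟨⟩⟩ f a ι dir cov p = k₀ , p
      ⟦⟧-⊆⋃ (⟨π₁⟩ φ) f a ι dir cov p = ⟦⟧-⊆⋃ φ f a ι dir cov p
      ⟦⟧-⊆⋃ (⟨π₂⟩ φ) f a ι dir cov p = ⟦⟧-⊆⋃ φ f a ι dir cov p
      ⟦⟧-⊆⋃ (⟨in₁⟩ φ) f a ι dir cov (y , p , x≡y) with ⟦⟧-⊆⋃ φ f a ι dir cov p
      ... | k , pₖ = k , y , pₖ , x≡y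
      ⟦⟧-⊆⋃ (⟨in₂⟩ φ) f a ι dir cov (y , p , x≡y) with ⟦⟧-⊆⋃ φ f a ι dir cov p
      ... | k , pₖ = k , y , pₖ , x≡y
      ⟦⟧-⊆⋃ (⟨fold⟩ φ) f a ι dir cov p = ⟦⟧-⊆⋃ φ f a ι dir cov p
      ⟦⟧-⊆⋃ (fvarF β) f a ι dir cov p = cov β p
      ⟦⟧-⊆⋃ (μF t φ) f a ι dir cov p = stage-⊆⋃ φ f a ι dir cov _ (⟦ t ⟧ᵗ ι) p
      ⟦⟧-⊆⋃ (νF t φ) f a ι dir cov p = stage-⊆⋃ φ f a ι dir cov _ (⟦ t ⟧ᵗ ι) p
      ⟦⟧-⊆⋃ (∃F i φ _) f a ι dir cov (n , p) with ⟦⟧-⊆⋃ φ f a _ dir cov p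
      ... | k , pₖ = k , n , ⟦⟧-mono φ (λ _ q → q) ([/ᵢ]-cong n i (λ _ → refl)) pₖ
      ⟦⟧-⊆⋃ (ψ ⇒F φ) f a ι dir cov p = k₀ , p

      stage-⊆⋃ : ∀ {Θ τ} (φ : Form plus (τ ∷ Θ) τ) (f : I → SetVal Θ) (a : SetVal Θ) ι →
        Directedₛ f → a ⊆⋃ₛ f → ∀ z n → stage φ a ι z n ⊆ ⋃ (λ k → stage φ (f k) ι z n)
      stage-⊆⋃ φ f a ι dir cov z zero p = k₀ , p
      stage-⊆⋃ φ f a ι dir cov z (suc n) =
        ⟦⟧-⊆⋃ φ (λ k → stage φ (f k) ι z n ∷ f k) (stage φ a ι z n ∷ a) ι
          (∷-directed {g = λ b → stage φ b ι z n} (stage-mono φ ι z n) dir) cov′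
        where
          cov′ : stage φ a ι z n ∷ a ⊆⋃ₛ (λ k → stage φ (f k) ι z n ∷ f k)
          cov′ (here refl) = stage-⊆⋃ φ f a ι dir cov z n
          cov′ (there β)   = cov β

    []≔-⋃ : ∀ {Θ σ} (xs : SetVal Θ) (α : σ ∈ Θ) (S : I → 𝒫 (D σ)) →
      xs [ α ]≔ ⋃ S ⊆⋃ₛ (λ k → xs [ α ]≔ S k)
    []≔-⋃ (x ∷ xs) (here refl) S (here refl) q = q
    []≔-⋃ (x ∷ xs) (here refl) S (there β)   q = k₀ , q
    []≔-⋃ (x ∷ xs) (there α)   S (here refl) q = k₀ , q
    []≔-⋃ (x ∷ xs) (there α)   S (there β)   q = []≔-⋃ xs α S β q

  module Cocontinuity (em : ExcludedMiddle 0ℓ) {I : Set} (k₀ : I) where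

    mutual
      ⋂⟦⟧-⊆ : ∀ {Θ τ} (φ : Form minus Θ τ) (f : I → SetVal Θ) (a : SetVal Θ) ι →
        Codirectedₛ f → ⋂ₛ f ⊆ a → ⋂ (λ k → ⟦ φ ⟧ (val (f k) ι)) ⊆ ⟦ φ ⟧ (val a ι)
      ⋂⟦⟧-⊆ ⊤f f a ι codir cov p = tt
      ⋂⟦⟧-⊆ ⊥f f a ι codir cov p = p k₀
      ⋂⟦⟧-⊆ (φ ∧f ψ) f a ι codir cov p =
        ⋂⟦⟧-⊆ φ f a ι codir cov (λ k → proj₁ (p k)) , ⋂⟦⟧-⊆ ψ f a ι codir cov (λ k → proj₂ (p k))
      ⋂⟦⟧-⊆ (φ ∨f ψ) f a ι codir cov {x} p
        with ∀⊎∀-codirected em (λ k → ⟦ φ ⟧ (val (f k) ι) x) (λ k → ⟦ ψ ⟧ (val (f k) ι) x)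
               (λ k l → let m , m≤k , m≤l = codir k l in m , ⟦⟧-monoˢ φ m≤k , ⟦⟧-monoˢ ψ m≤l) p
      ... | inj₁ ⋂φ = inj₁ (⋂⟦⟧-⊆ φ f a ι codir cov ⋂φ)
      ... | inj₂ ⋂ψ = inj₂ (⋂⟦⟧-⊆ ψ f a ι codir cov ⋂ψ)
      ⋂⟦⟧-⊆ ⟨⟨⟩⟩ f a ι codir cov p = p k₀
      ⋂⟦⟧-⊆ (⟨π₁⟩ φ) f a ι codir cov p = ⋂⟦⟧-⊆ φ f a ι codir cov p
      ⋂⟦⟧-⊆ (⟨π₂⟩ φ) f a ι codir cov p = ⋂⟦⟧-⊆ φ f a ι codir cov p
      ⋂⟦⟧-⊆ (⟨in₁⟩ φ) f a ι codir cov p =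
        let y , ⋂φ , x≡y = injective-image-⋂ in₁-inj (λ k → ⟦ φ ⟧ (val (f k) ι)) k₀ p
        in y , ⋂⟦⟧-⊆ φ f a ι codir cov ⋂φ , x≡y
      ⋂⟦⟧-⊆ (⟨in₂⟩ φ) f a ι codir cov p =
        let y , ⋂φ , x≡y = injective-image-⋂ in₂-inj (λ k → ⟦ φ ⟧ (val (f k) ι)) k₀ p
        in y , ⋂⟦⟧-⊆ φ f a ι codir cov ⋂φ , x≡y
      ⋂⟦⟧-⊆ (⟨fold⟩ φ) f a ι codir cov p = ⋂⟦⟧-⊆ φ f a ι codir cov p
      ⋂⟦⟧-⊆ (fvarF β) f a ι codir cov p = cov β p
      ⋂⟦⟧-⊆ (μF t φ) f a ι codir cov p = ⋂stage-⊆ φ f a ι codir cov _ (⟦ t ⟧ᵗ ι) p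
      ⋂⟦⟧-⊆ (νF t φ) f a ι codir cov p = ⋂stage-⊆ φ f a ι codir cov _ (⟦ t ⟧ᵗ ι) p
      ⋂⟦⟧-⊆ (∀F i φ _) f a ι codir cov p n = ⋂⟦⟧-⊆ φ f a _ codir cov
        (λ k → ⟦⟧-mono φ (λ _ q → q) ([/ᵢ]-cong n i (λ _ → refl)) (p k n))
      ⋂⟦⟧-⊆ (ψ ⇒F φ) f a ι codir cov p = p k₀

      ⋂stage-⊆ : ∀ {Θ τ} (φ : Form minus (τ ∷ Θ) τ) (f : I → SetVal Θ) (a : SetVal Θ) ι →
        Codirectedₛ f → ⋂ₛ f ⊆ a → ∀ z n → ⋂ (λ k → stage φ (f k) ι z n) ⊆ stage φ a ι z n
      ⋂stage-⊆ φ f a ι codir cov z zero p = p k₀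
      ⋂stage-⊆ φ f a ι codir cov z (suc n) =
        ⋂⟦⟧-⊆ φ (λ k → stage φ (f k) ι z n ∷ f k) (stage φ a ι z n ∷ a) ι
          (∷-codirected {g = λ b → stage φ b ι z n} (stage-mono φ ι z n) codir) cov′
        where
          cov′ : ⋂ₛ (λ k → stage φ (f k) ι z n ∷ f k) ⊆ stage φ a ι z n ∷ a
          cov′ (here refl) = ⋂stage-⊆ φ f a ι codir cov z n
          cov′ (there β)   = cov β

    ⋂[]≔-⊆ : ∀ {Θ σ} (xs : SetVal Θ) (α : σ ∈ Θ) (S : I → 𝒫 (D σ)) →
      ⋂ₛ (λ k → xs [ α ]≔ S k) ⊆ xs [ α ]≔ ⋂ S
    ⋂[]≔-⊆ (x ∷ xs) (here refl) S (here refl) q = q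
    ⋂[]≔-⊆ (x ∷ xs) (here refl) S (there β)   q = q k₀
    ⋂[]≔-⊆ (x ∷ xs) (there α)   S (here refl) q = q k₀
    ⋂[]≔-⊆ (x ∷ xs) (there α)   S (there β)   q = ⋂[]≔-⊆ xs α S β q

  module _ {Θ σ} (ρ : Val Θ) (α : σ ∈ Θ) where

    Fφ-monotone : ∀ {s τ} (φ : Form s Θ τ) → Monotone (Fφ φ ρ α)
    Fφ-monotone φ S⊆T = ⟦⟧-monoˢ φ ([]≔-mono (sets ρ) α S⊆T)

    Fφ-continuous : ∀ {τ} (φ : Form plus Θ τ) → ScottContinuous (Fφ φ ρ α)
    Fφ-continuous φ I S (k₀ , dir) =
        ⟦⟧-⊆⋃ φ _ _ (iters ρ) ([]≔-directed (sets ρ) α dir) ([]≔-⋃ (sets ρ) α S)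
      , monotone-⋃⊆ (Fφ-monotone φ) S
      where open Continuity k₀

    Fφ-cocontinuous : ExcludedMiddle 0ℓ → ∀ {τ} (φ : Form minus Θ τ) →
      ScottCocontinuous (Fφ φ ρ α)
    Fφ-cocontinuous em φ I S (k₀ , codir) =
        monotone-⊆⋂ (Fφ-monotone φ) S
      , ⋂⟦⟧-⊆ φ _ _ (iters ρ) ([]≔-codirected (sets ρ) α codir) (⋂[]≔-⊆ (sets ρ) α S)
      where open Cocontinuity em k₀

proposition5p9 : (M : Model) → ∀ {Θ : FCtx} {σ τ : PType}
    (ρ : Semantics.Val M Θ) (α : σ ∈ Θ) →
      ((s : Sign) (φ : Form s Θ τ) → Monotone (Semantics.Fφ M φ ρ α))
      × ((φ : Form plus Θ τ) → ScottContinuous (Semantics.Fφ M φ ρ α))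
      × (ExcludedMiddle 0ℓ → (φ : Form minus Θ τ) → ScottCocontinuous (Semantics.Fφ M φ ρ α))
proposition5p9 M ρ α =
  (λ _ → Fφ-monotone M ρ α) , Fφ-continuous M ρ α , λ em → Fφ-cocontinuous M ρ α em
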